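{- Let $n\ge3$. For every $\sigma\in S_{2n}$, $|\mathrm{class}(\sigma)|\ge 4$ and $|\mathrm{class}(\sigma)|$ is a multiple of $4$.
   Context: A Dyck path of size $n$ is a word in $\mathtt{u},\mathtt{d}$ with $n$ of each letter whose every prefix has at least as many $\mathtt{u}$'s as $\mathtt{d}$'s; $\mathcal{D}_n$ is their set. The tunneling $\tau_D\in S_{2n}$ of $D$ is the fixed-point-free involution pairing each up-step position with the position of its matching down-step. For $\sigma\in S_{2n}$, write $\sigma_k=\sigma(k)$, $\sigma_{[k]}=\{\sigma_1,\dots,\sigma_k\}$; the $\sigma$-path $\sigma(D)$ is the word with $\sigma(D)_k=\mathtt{u}$ if $\tau_D(\sigma_k)\notin\sigma_{[k]}$ and $\mathtt{d}$ otherwise. Define an equivalence relation on $S_{2n}$ by $\lambda\sim\mu$ iff $\lambda(D)=\mu(D)$ for all $D\in\mathcal{D}_n$; $\mathrm{class}(\sigma)$ is the equivalence class of $\sigma$. -}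

module Defs where

open import Data.Bool using (Bool; true; false; _∧_; _∨_; not; if_then_else_)
open import Data.Nat using (ℕ; zero; suc; _+_; _∸_; _<ᵇ_; _≡ᵇ_)
open import Data.Integer as ℤ using (ℤ; +_; -[1+_])
open import Data.Fin using (Fin; toℕ)
open import Data.List using (List; []; _∷_; map; take; foldr; upTo; allFin; concatMap; filter; length)
open import Data.Bool.ListAction using (all; any)
open import Data.List.Properties using (≡-dec)
open import Data.Vec using (Vec; []; _∷_; toList)
open import Relation.Nullary.Decidable using (⌊_⌋)
import Data.Bool.Properties as BP

-- Words over {u,d}: true = u, false = d.  Positions are 0-indexed
-- (position i here = position i+1 in the paper).

-- the letter at position i (default d out of range; never used there)
letter : List Bool → ℕ → Bool
letter []       _       = false
letter (x ∷ _)  zero    = x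
letter (_ ∷ xs) (suc i) = letter xs i

step : Bool → ℤ
step true  = + 1
step false = -[1+ 0 ]

height : List Bool → ℕ → ℤ
height w k = foldr ℤ._+_ (+ 0) (map step (take k w))

_==ℤ_ : ℤ → ℤ → Bool
a ==ℤ b = ⌊ a ℤ.≟ b ⌋

_<ℤ_ : ℤ → ℤ → Bool
a <ℤ b = ⌊ a ℤ.<? b ⌋

_≤ℤ_ : ℤ → ℤ → Bool
a ≤ℤ b = ⌊ a ℤ.≤? b ⌋

isDyck : List Bool → Bool
isDyck w = all (λ k → (+ 0) ≤ℤ height w k) (upTo (suc (length w)))
           ∧ (height w (length w) ==ℤ (+ 0))

allWords : ℕ → List (List Bool)
allWords zero    = [] ∷ []
allWords (suc k) = concatMap (λ b → map (b ∷_) (allWords k)) (true ∷ false ∷ [])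

dyckPaths : ℕ → List (List Bool)
dyckPaths n = filter (λ w → isDyck w Data.Bool.≟ true) (allWords (n + n))
  where import Data.Bool

matched : List Bool → ℕ → ℕ → Bool
matched w i j =
  (i <ᵇ j) ∧ letter w i ∧ not (letter w j)
  ∧ (height w i ==ℤ height w (suc j))
  ∧ all (λ t → height w i <ℤ height w t) (map (λ x → suc i + x) (upTo (j ∸ i)))

-- τ_D(a) ≡ b, i.e. {a,b} is a tunnel pair of D
tunnelPair : List Bool → ℕ → ℕ → Bool
tunnelPair w a b = matched w a b ∨ matched w b a

-- Permutations of S_m in one-line notation: σ = (σ_1,…,σ_m) with
-- entries in Fin m (0-indexed), all distinct.

entries : ∀ {m} → Vec (Fin m) m → List ℕ
entries σ = toList (Data.Vec.map toℕ σ)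
  where import Data.Vec

nth : List ℕ → ℕ → ℕ
nth []       _       = 0
nth (x ∷ _)  zero    = x
nth (_ ∷ xs) (suc i) = nth xs i

distinct : List ℕ → Bool
distinct []       = true
distinct (x ∷ xs) = all (λ y → not (x ≡ᵇ y)) xs ∧ distinct xs

isPerm : ∀ {m} → Vec (Fin m) m → Bool
isPerm σ = distinct (entries σ)

-- σ-path σ(D): k-th letter is u iff τ_D(σ_k) ∉ σ_[k] = {σ_1,…,σ_k}
sigmaPath : ∀ {m} → Vec (Fin m) m → List Bool → List Bool
sigmaPath {m} σ D =
  map (λ k → not (any (λ t → tunnelPair D (nth s k) (nth s t)) (upTo (suc k))))
      (upTo m)
  where s = entries σ

_==w_ : List Bool → List Bool → Bool
v ==w w = ⌊ ≡-dec BP._≟_ v w ⌋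

equiv : (n : ℕ) → Vec (Fin (n + n)) (n + n) → Vec (Fin (n + n)) (n + n) → Bool
equiv n λ' μ = all (λ D → sigmaPath λ' D ==w sigmaPath μ D) (dyckPaths n)

allVecs : (m k : ℕ) → List (Vec (Fin m) k)
allVecs m zero    = [] ∷ []
allVecs m (suc k) = concatMap (λ i → map (i ∷_) (allVecs m k)) (allFin m)

classSize : (n : ℕ) → Vec (Fin (n + n)) (n + n) → ℕ
classSize n σ =
  length (filter (λ μ → (isPerm μ ∧ equiv n μ σ) Data.Bool.≟ true) (allVecs (n + n) (n + n)))
  where import Data.Bool

-- Transposing the first two entries of σ, or its last two, changes no σ-path.
-- At the front, σ(D)₁ = u always, σ(D)₂ = u iff σ₁ and σ₂ do not form a tunnel
-- (a symmetric condition), and every later letter only sees the set σ_[k].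
-- At the back, σ_[2n] is everything, so σ(D)_{2n} = d always and σ(D)_{2n-1} = u
-- iff σ_{2n-1} and σ_{2n} form a tunnel.  For 2n ≥ 4 the two transpositions
-- generate a Klein four-group acting freely on S_{2n} and preserving classes.
-- Concretely, |class σ| is a sum over all words of an indicator; splitting off
-- the first two and the last two entries writes it as sums of symmetric
-- matrices with zero diagonal, each of which is even, so 2 · 2 divides it,
-- and σ itself contributes 1.
module Submission where

open import Defs
open import Data.Bool using (Bool; true; false; not; _∧_; _∨_; if_then_else_)
import Data.Bool as Bool
import Data.Bool.Properties as BP
open import Data.Bool.ListAction using (all; any; and; or)
open import Data.Nat using (ℕ; zero; suc; _+_; _*_; _∸_; _≤_; _<_; _<ᵇ_; _≡ᵇ_; s≤s; z≤n; >-nonZero)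
import Data.Nat.Properties as ℕP
open import Data.Nat.ListAction using (sum)
import Data.Nat.ListAction.Properties as SumP
open import Data.Nat.Divisibility using (_∣_; _∣0; 1∣_; ∣m∣n⇒∣m+n; *-monoʳ-∣; ∣⇒≤)
open import Data.Integer as ℤ using (ℤ; 0ℤ)
import Data.Integer.Properties as ℤP
open import Data.Fin using (Fin; zero; suc; toℕ; fromℕ<)
import Data.Fin.Properties as FinP
open import Data.Vec using (Vec; []; _∷_; toList)
import Data.Vec as Vec
open import Data.List using (List; []; _∷_; _++_; map; concatMap; filter; take; upTo; applyUpTo; allFin; tabulate; length; lookup)
import Data.List.Properties as ListP
open import Data.List.Membership.Propositional using (_∈_; _∉_)
open import Data.List.Membership.Propositional.Properties
  using (∈-upTo⁺; ∈-upTo⁻; ∈-map⁺; ∈-map⁻; ∈-++⁺ʳ; ∈-++⁻; ∈-lookup; ∈-filter⁻; ∈-concatMap⁻)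
open import Data.List.Membership.DecPropositional ℕP._≟_ using (_∈?_)
open import Data.List.Relation.Unary.Any using (here; there)
import Data.List.Relation.Unary.All as All
open import Data.List.Relation.Unary.All.Properties using (applyUpTo⁺₁)
open import Data.List.Relation.Binary.Permutation.Propositional as ↭ using (_↭_; ↭-swap; ↭-refl; ↭-sym)
open import Data.List.Relation.Binary.Permutation.Propositional.Properties using (++⁺ˡ; ∈-resp-↭; ↭-length; ++-comm)
open import Data.Product using (∃-syntax; _×_; _,_; proj₁; proj₂)
open import Data.Sum using (_⊎_; inj₁; inj₂)
open import Data.Empty using (⊥-elim)
open import Function using (Equivalence; _∘_)
open import Relation.Nullary using (Dec; yes; no; ¬_)
open import Relation.Nullary.Decidable using (⌊_⌋)
open import Relation.Binary using (tri<; tri≈; tri>)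
open import Relation.Binary.PropositionalEquality using (_≡_; refl; sym; trans; cong; cong₂; subst; module ≡-Reasoning)
open import Algebra.Bundles using (CommutativeMonoid)
open import Algebra.Properties.CommutativeSemigroup ℤP.+-commutativeSemigroup
  using () renaming (x∙yz≈y∙xz to +-exchange)
open import Algebra.Properties.CommutativeSemigroup (CommutativeMonoid.commutativeSemigroup BP.∨-commutativeMonoid)
  using () renaming (x∙yz≈y∙xz to ∨-exchange)
open import Algebra.Properties.CommutativeSemigroup (CommutativeMonoid.commutativeSemigroup BP.∧-commutativeMonoid)
  using () renaming (x∙yz≈y∙xz to ∧-exchange; interchange to ∧-interchange)
open import Algebra.Properties.Monoid.Sum ℕP.+-0-monoid using (sum-syntax; sum-cong-≗) renaming (sum to ∑)
open import Algebra.Properties.CommutativeMonoid.Sum ℕP.+-0-commutativeMonoid using (∑-distrib-+; ∑-comm)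
open ≡-Reasoning

∧-true⁻ : ∀ {a b} → a ∧ b ≡ true → a ≡ true × b ≡ true
∧-true⁻ {true} e = refl , e

∨-true⁻ : ∀ {a b} → a ∨ b ≡ true → a ≡ true ⊎ b ≡ true
∨-true⁻ {true}  _ = inj₁ refl
∨-true⁻ {false} e = inj₂ e

¬true⇒false : ∀ {b} → ¬ (b ≡ true) → b ≡ false
¬true⇒false {false} _  = refl
¬true⇒false {true}  ¬t = ⊥-elim (¬t refl)

⌊⌋-true⁻ : ∀ {P : Set} (d : Dec P) → ⌊ d ⌋ ≡ true → P
⌊⌋-true⁻ (yes p) _ = p

⌊⌋-false⁻ : ∀ {P : Set} (d : Dec P) → ⌊ d ⌋ ≡ false → ¬ P
⌊⌋-false⁻ (no ¬p) _ = ¬p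

⌊⌋-true⁺ : ∀ {P : Set} (d : Dec P) → P → ⌊ d ⌋ ≡ true
⌊⌋-true⁺ (yes _) _ = refl
⌊⌋-true⁺ (no ¬p) p = ⊥-elim (¬p p)

⌊⌋-false⁺ : ∀ {P : Set} (d : Dec P) → ¬ P → ⌊ d ⌋ ≡ false
⌊⌋-false⁺ (yes p) ¬p = ⊥-elim (¬p p)
⌊⌋-false⁺ (no _)  _  = refl

<ᵇ-true⁻ : ∀ {m n} → (m <ᵇ n) ≡ true → m < n
<ᵇ-true⁻ {m} {n} e = ℕP.<ᵇ⇒< m n (Equivalence.from BP.T-≡ e)

<ᵇ-true⁺ : ∀ {m n} → m < n → (m <ᵇ n) ≡ true
<ᵇ-true⁺ m<n = Equivalence.to BP.T-≡ (ℕP.<⇒<ᵇ m<n)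

≡ᵇ-refl : ∀ n → (n ≡ᵇ n) ≡ true
≡ᵇ-refl n = Equivalence.to BP.T-≡ (ℕP.≡⇒≡ᵇ n n refl)

≡ᵇ-sym : ∀ m n → (m ≡ᵇ n) ≡ (n ≡ᵇ m)
≡ᵇ-sym zero    zero    = refl
≡ᵇ-sym zero    (suc n) = refl
≡ᵇ-sym (suc m) zero    = refl
≡ᵇ-sym (suc m) (suc n) = ≡ᵇ-sym m n

all-true⁻ : ∀ {A : Set} (p : A → Bool) xs {x} → all p xs ≡ true → x ∈ xs → p x ≡ true
all-true⁻ p (y ∷ ys) e (here refl) = proj₁ (∧-true⁻ e)
all-true⁻ p (y ∷ ys) e (there x∈)  = all-true⁻ p ys (proj₂ (∧-true⁻ {p y} e)) x∈

all-true⁺ : ∀ {A : Set} (p : A → Bool) xs → (∀ {x} → x ∈ xs → p x ≡ true) → all p xs ≡ true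
all-true⁺ p []       _ = refl
all-true⁺ p (y ∷ ys) h rewrite h (here refl) = all-true⁺ p ys (h ∘ there)

all-cong-local : ∀ {A : Set} {p q : A → Bool} xs → (∀ {x} → x ∈ xs → p x ≡ q x) → all p xs ≡ all q xs
all-cong-local xs p≗q = cong and (ListP.map-cong-local (All.tabulate p≗q))

any-true⁺ : ∀ {A : Set} (p : A → Bool) {xs x} → x ∈ xs → p x ≡ true → any p xs ≡ true
any-true⁺ p         (here refl) px rewrite px = refl
any-true⁺ p {y ∷ _} (there x∈)  px rewrite any-true⁺ p x∈ px = BP.∨-zeroʳ (p y)

any-true⁻ : ∀ {A : Set} (p : A → Bool) xs → any p xs ≡ true → ∃[ x ] x ∈ xs × p x ≡ true
any-true⁻ p (x ∷ xs) e with ∨-true⁻ {p x} e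
... | inj₁ px   = x , here refl , px
... | inj₂ rest with y , y∈ , py ← any-true⁻ p xs rest = y , there y∈ , py

any-++ : ∀ {A : Set} (p : A → Bool) xs ys → any p (xs ++ ys) ≡ any p xs ∨ any p ys
any-++ p []       ys = refl
any-++ p (x ∷ xs) ys = trans (cong (p x ∨_) (any-++ p xs ys)) (sym (BP.∨-assoc (p x) _ _))

-- Heights and tunnels of a Dyck word

height-suc : ∀ w k → k < length w → height w (suc k) ≡ step (letter w k) ℤ.+ height w k
height-suc (x ∷ w) zero    _        = refl
height-suc (x ∷ w) (suc k) (s≤s k<) = trans (cong (λ h → step x ℤ.+ h) (height-suc w k k<))
                                             (+-exchange (step x) (step (letter w k)) (height w k))

Dyck⇒height-nonneg : ∀ w → isDyck w ≡ true → ∀ {k} → k ≤ length w → 0ℤ ℤ.≤ height w k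
Dyck⇒height-nonneg w dyck k≤ = ⌊⌋-true⁻ (0ℤ ℤ.≤? _)
  (all-true⁻ (λ k → 0ℤ ≤ℤ height w k) (upTo (suc (length w))) (proj₁ (∧-true⁻ dyck)) (∈-upTo⁺ (s≤s k≤)))

Dyck⇒height-final : ∀ w → isDyck w ≡ true → height w (length w) ≡ 0ℤ
Dyck⇒height-final w dyck =
  ⌊⌋-true⁻ (_ ℤ.≟ 0ℤ) (proj₂ (∧-true⁻ {all (λ k → 0ℤ ≤ℤ height w k) (upTo (suc (length w)))} dyck))

step-up-lands : ∀ b {x c} → x ℤ.≤ c → c ℤ.< step b ℤ.+ x → b ≡ true × x ≡ c
step-up-lands true  {x} {c} x≤c c<1+x =
  refl , ℤP.≤-antisym x≤c (subst (c ℤ.≤_) (ℤP.pred-suc x) (ℤP.i<j⇒i≤pred[j] c<1+x))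
step-up-lands false x≤c c<x-1 = ⊥-elim (ℤP.<⇒≱ c<x-1 (ℤP.i≤j⇒pred[i]≤j x≤c))

step-down-lands : ∀ b {x c} → c ℤ.< x → step b ℤ.+ x ℤ.≤ c → b ≡ false × step b ℤ.+ x ≡ c
step-down-lands true  {x} c<x 1+x≤c = ⊥-elim (ℤP.<⇒≱ c<x (ℤP.≤-trans (ℤP.i≤suc[i] x) 1+x≤c))
step-down-lands false c<x x-1≤c = refl , ℤP.≤-antisym x-1≤c (ℤP.i<j⇒i≤pred[j] c<x)

record Tunnel (w : List Bool) (i j : ℕ) : Set where
  field
    i<j     : i < j
    up      : letter w i ≡ true
    down    : letter w j ≡ false
    returns : height w i ≡ height w (suc j)
    above   : ∀ {t} → i < t → t ≤ j → height w i ℤ.< height w t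

matched⇒Tunnel : ∀ w i j → matched w i j ≡ true → Tunnel w i j
matched⇒Tunnel w i j m
  with i<ᵇj , m₁ ← ∧-true⁻ m
  with up , m₂ ← ∧-true⁻ m₁
  with down , m₃ ← ∧-true⁻ m₂
  with returns , between ← ∧-true⁻ m₃
  = record
  { i<j     = <ᵇ-true⁻ i<ᵇj
  ; up      = up
  ; down    = BP.not-injective down
  ; returns = ⌊⌋-true⁻ (height w i ℤ.≟ height w (suc j)) returns
  ; above   = above }
  where
  above : ∀ {t} → i < t → t ≤ j → height w i ℤ.< height w t
  above {t} i<t t≤j = ⌊⌋-true⁻ (height w i ℤ.<? height w t)
    (subst (λ u → (height w i <ℤ height w u) ≡ true) (ℕP.m+[n∸m]≡n i<t)
      (all-true⁻ _ _ between (∈-map⁺ (λ x → suc i + x) (∈-upTo⁺ (ℕP.∸-monoˡ-< (s≤s t≤j) i<t)))))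

Tunnel⇒matched : ∀ {w i j} → Tunnel w i j → matched w i j ≡ true
Tunnel⇒matched {w} {i} {j} τ
  rewrite <ᵇ-true⁺ (Tunnel.i<j τ) | Tunnel.up τ | Tunnel.down τ
        | ⌊⌋-true⁺ (height w i ℤ.≟ height w (suc j)) (Tunnel.returns τ)
  = all-true⁺ _ _ between
  where
  open Tunnel τ
  between : ∀ {t} → t ∈ map (λ x → suc i + x) (upTo (j ∸ i)) → (height w i <ℤ height w t) ≡ true
  between t∈ with x , x∈ , refl ← ∈-map⁻ (λ x → suc i + x) t∈ =
    ⌊⌋-true⁺ (_ ℤ.<? _) (above (s≤s (ℕP.m≤m+n i x))
      (subst (suc (i + x) ≤_) (ℕP.m+[n∸m]≡n (ℕP.<⇒≤ i<j)) (ℕP.+-monoʳ-< i (∈-upTo⁻ x∈))))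

Tunnel⇒tunnelPair : ∀ {w i j} → Tunnel w i j → tunnelPair w i j ≡ true
Tunnel⇒tunnelPair {w} {i} {j} τ = cong (_∨ matched w j i) (Tunnel⇒matched τ)

Tunnel-functional : ∀ {w i j k} → Tunnel w i j → Tunnel w i k → j ≡ k
Tunnel-functional τ₁ τ₂ = ℕP.≤-antisym (ℕP.≮⇒≥ (first-return τ₂ τ₁)) (ℕP.≮⇒≥ (first-return τ₁ τ₂))
  where
  first-return : ∀ {w i j k} → Tunnel w i j → Tunnel w i k → ¬ (j < k)
  first-return τ τ′ j<k = ℤP.<-irrefl (Tunnel.returns τ)
    (Tunnel.above τ′ (ℕP.<-trans (Tunnel.i<j τ) (ℕP.n<1+n _)) j<k)

Tunnel-injective : ∀ {w i j k} → Tunnel w i k → Tunnel w j k → i ≡ j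
Tunnel-injective τ₁ τ₂ = ℕP.≤-antisym (ℕP.≮⇒≥ (last-departure τ₂ τ₁)) (ℕP.≮⇒≥ (last-departure τ₁ τ₂))
  where
  last-departure : ∀ {w i j k} → Tunnel w i k → Tunnel w j k → ¬ (i < j)
  last-departure τ τ′ i<j = ℤP.<-irrefl (trans (Tunnel.returns τ) (sym (Tunnel.returns τ′)))
    (Tunnel.above τ i<j (ℕP.<⇒≤ (Tunnel.i<j τ′)))

Tunnel-start≢end : ∀ {w a b c} → Tunnel w a b → ¬ Tunnel w c a
Tunnel-start≢end τ τ′ = BP.not-¬ (Tunnel.up τ) (Tunnel.down τ′)

tunnelPair-irrefl : ∀ w a → tunnelPair w a a ≡ false
tunnelPair-irrefl w a = cong (λ b → b ∨ b) (¬true⇒false λ m →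
  ℕP.<-irrefl refl (Tunnel.i<j (matched⇒Tunnel w a a m)))

tunnelPair-sym : ∀ w a b → tunnelPair w a b ≡ tunnelPair w b a
tunnelPair-sym w a b = BP.∨-comm (matched w a b) (matched w b a)

tunnelPair-functional : ∀ w {a b c} → tunnelPair w a b ≡ true → tunnelPair w a c ≡ true → b ≡ c
tunnelPair-functional w {a} {b} {c} ab ac with ∨-true⁻ ab | ∨-true⁻ ac
... | inj₁ m₁ | inj₁ m₂ = Tunnel-functional (matched⇒Tunnel w a b m₁) (matched⇒Tunnel w a c m₂)
... | inj₂ m₁ | inj₂ m₂ = Tunnel-injective (matched⇒Tunnel w b a m₁) (matched⇒Tunnel w c a m₂)
... | inj₁ m₁ | inj₂ m₂ = ⊥-elim (Tunnel-start≢end (matched⇒Tunnel w a b m₁) (matched⇒Tunnel w c a m₂))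
... | inj₂ m₁ | inj₁ m₂ = ⊥-elim (Tunnel-start≢end (matched⇒Tunnel w a c m₂) (matched⇒Tunnel w b a m₁))

first-crossing : (P : ℕ → Bool) → ∀ s k → P s ≡ false → P (s + k) ≡ true →
  ∃[ j ] s ≤ j × j < s + k × P (suc j) ≡ true × (∀ {t} → s ≤ t → t ≤ j → P t ≡ false)
first-crossing P s zero Ps Ps+0 = ⊥-elim (BP.not-¬ (subst (λ t → P t ≡ true) (ℕP.+-identityʳ s) Ps+0) Ps)
first-crossing P s (suc k) Ps Pe with P (suc s) in Ps+1
... | true  = s , ℕP.≤-refl , ℕP.m<m+n s (s≤s z≤n) , Ps+1 ,
              λ s≤t t≤s → subst (λ t → P t ≡ false) (ℕP.≤-antisym s≤t t≤s) Ps
... | false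
  with j , s<j , j< , Pj+1 , below ← first-crossing P (suc s) k Ps+1 (trans (cong P (sym (ℕP.+-suc s k))) Pe)
  = j , ℕP.<⇒≤ s<j , subst (j <_) (sym (ℕP.+-suc s k)) j< , Pj+1 , below′
  where
  below′ : ∀ {t} → s ≤ t → t ≤ j → P t ≡ false
  below′ {t} s≤t t≤j with t ℕP.≟ s
  ... | yes refl = Ps
  ... | no t≢s   = below (ℕP.≤∧≢⇒< s≤t (t≢s ∘ sym)) t≤j

last-crossing : (P : ℕ → Bool) → ∀ s k → P s ≡ true → P (s + k) ≡ false →
  ∃[ i ] s ≤ i × i < s + k × P i ≡ true × (∀ {t} → i < t → t ≤ s + k → P t ≡ false)
last-crossing P s zero Ps Ps+0 = ⊥-elim (BP.not-¬ Ps (subst (λ t → P t ≡ false) (ℕP.+-identityʳ s) Ps+0))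
last-crossing P s (suc k) Ps Pe with P (s + k) in Pe-1
... | true  = s + k , ℕP.m≤m+n s k , e-1<e , Pe-1 , above
  where
  e-1<e : s + k < s + suc k
  e-1<e = ℕP.+-monoʳ-< s ℕP.≤-refl
  above : ∀ {t} → s + k < t → t ≤ s + suc k → P t ≡ false
  above {t} e-1<t t≤e =
    subst (λ t → P t ≡ false) (ℕP.≤-antisym (subst (_≤ t) (sym (ℕP.+-suc s k)) e-1<t) t≤e) Pe
... | false
  with i , s≤i , i< , Pi , above ← last-crossing P s k Ps Pe-1
  = i , s≤i , ℕP.<-trans i< (ℕP.+-monoʳ-< s ℕP.≤-refl) , Pi , above′
  where
  above′ : ∀ {t} → i < t → t ≤ s + suc k → P t ≡ false
  above′ {t} i<t t≤e with t ℕP.≟ s + suc k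
  ... | yes refl = Pe
  ... | no t≢e   = above i<t (ℕP.≤-pred (subst (suc t ≤_) (ℕP.+-suc s k) (ℕP.≤∧≢⇒< t≤e t≢e)))

-- An up-step is matched where the path first comes back down to its level,
-- a down-step where the path last left the level it lands on.
module _ (w : List Bool) (dyck : isDyck w ≡ true) {a} (a<L : a < length w) where
  private
    L : ℕ
    L = length w

  module _ (up : letter w a ≡ true) where
    private
      c : ℤ
      c = height w a

      P : ℕ → Bool
      P t = height w t ≤ℤ c

      P[a+1] : P (suc a) ≡ false
      P[a+1] = ⌊⌋-false⁺ (_ ℤ.≤? c) (ℤP.<⇒≱ (subst (c ℤ.<_) (sym h[a+1]) (ℤP.suc[i]≤j⇒i<j ℤP.≤-refl)))
        where
        h[a+1] : height w (suc a) ≡ ℤ.suc c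
        h[a+1] = trans (height-suc w a a<L) (cong (λ b → step b ℤ.+ c) up)

      P[L] : P (suc a + (L ∸ suc a)) ≡ true
      P[L] = subst (λ t → P t ≡ true) (sym (ℕP.m+[n∸m]≡n a<L)) (⌊⌋-true⁺ (_ ℤ.≤? c)
        (subst (ℤ._≤ c) (sym (Dyck⇒height-final w dyck)) (Dyck⇒height-nonneg w dyck (ℕP.<⇒≤ a<L))))

    Dyck⇒up-partner : ∃[ j ] j < length w × Tunnel w a j
    Dyck⇒up-partner
      with j , a<j , j<L′ , P[j+1] , below ← first-crossing P (suc a) (L ∸ suc a) P[a+1] P[L]
      = j , j<L , record
        { i<j = a<j ; up = up ; down = proj₁ lands
        ; returns = sym (trans (height-suc w j j<L) (proj₂ lands))
        ; above = λ a<t t≤j → ℤP.≰⇒> (⌊⌋-false⁻ (_ ℤ.≤? c) (below a<t t≤j)) }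
      where
      j<L : j < L
      j<L = subst (j <_) (ℕP.m+[n∸m]≡n a<L) j<L′
      lands : letter w j ≡ false × step (letter w j) ℤ.+ height w j ≡ c
      lands = step-down-lands (letter w j) (ℤP.≰⇒> (⌊⌋-false⁻ (_ ℤ.≤? c) (below a<j ℕP.≤-refl)))
                (subst (ℤ._≤ c) (height-suc w j j<L) (⌊⌋-true⁻ (_ ℤ.≤? c) P[j+1]))

  module _ (down : letter w a ≡ false) where
    private
      c : ℤ
      c = height w (suc a)

      P : ℕ → Bool
      P t = height w t ≤ℤ c

      P[0] : P 0 ≡ true
      P[0] = ⌊⌋-true⁺ (_ ℤ.≤? c) (Dyck⇒height-nonneg w dyck a<L)

      P[a] : P a ≡ false
      P[a] = ⌊⌋-false⁺ (_ ℤ.≤? c) (ℤP.<⇒≱ (subst (ℤ._< height w a) (sym h[a+1]) (ℤP.i≤pred[j]⇒i<j ℤP.≤-refl)))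
        where
        h[a+1] : c ≡ ℤ.pred (height w a)
        h[a+1] = trans (height-suc w a a<L) (cong (λ b → step b ℤ.+ height w a) down)

    Dyck⇒down-partner : ∃[ i ] i < length w × Tunnel w i a
    Dyck⇒down-partner
      with i , _ , i<a , P[i] , above ← last-crossing P 0 a P[0] P[a]
      = i , ℕP.<-trans i<a a<L , record
        { i<j = i<a ; up = proj₁ lands ; down = down ; returns = proj₂ lands
        ; above = λ i<t t≤a → subst (ℤ._< _) (sym (proj₂ lands)) (ℤP.≰⇒> (⌊⌋-false⁻ (_ ℤ.≤? c) (above i<t t≤a))) }
      where
      lands : letter w i ≡ true × height w i ≡ c
      lands = step-up-lands (letter w i) (⌊⌋-true⁻ (_ ℤ.≤? c) P[i])
                (subst (c ℤ.<_) (height-suc w i (ℕP.<-trans i<a a<L))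
                  (ℤP.≰⇒> (⌊⌋-false⁻ (_ ℤ.≤? c) (above (ℕP.n<1+n i) i<a))))

Dyck⇒tunnelPair-total : ∀ w → isDyck w ≡ true → ∀ {a} → a < length w →
  ∃[ b ] b < length w × tunnelPair w a b ≡ true
Dyck⇒tunnelPair-total w dyck {a} a<L = by-letter (letter w a) refl
  where
  by-letter : ∀ b → letter w a ≡ b → ∃[ b ] b < length w × tunnelPair w a b ≡ true
  by-letter true up with j , j<L , τ ← Dyck⇒up-partner w dyck a<L up =
    j , j<L , Tunnel⇒tunnelPair τ
  by-letter false down with i , i<L , τ ← Dyck⇒down-partner w dyck a<L down =
    i , i<L , trans (tunnelPair-sym w a i) (Tunnel⇒tunnelPair τ)

all-resp-↭ : ∀ {A : Set} (p : A → Bool) {xs ys} → xs ↭ ys → all p xs ≡ all p ys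
all-resp-↭ p ↭.refl           = refl
all-resp-↭ p (↭.prep x xs↭)   = cong (p x ∧_) (all-resp-↭ p xs↭)
all-resp-↭ p (↭.swap x y xs↭) = trans (cong (λ b → p x ∧ (p y ∧ b)) (all-resp-↭ p xs↭)) (∧-exchange (p x) (p y) _)
all-resp-↭ p (↭.trans ↭₁ ↭₂)  = trans (all-resp-↭ p ↭₁) (all-resp-↭ p ↭₂)

distinct-resp-↭ : ∀ {xs ys} → xs ↭ ys → distinct xs ≡ distinct ys
distinct-resp-↭ ↭.refl          = refl
distinct-resp-↭ (↭.prep x xs↭)  = cong₂ _∧_ (all-resp-↭ _ xs↭) (distinct-resp-↭ xs↭)
distinct-resp-↭ {x ∷ y ∷ xs} {_ ∷ _ ∷ ys} (↭.swap _ _ xs↭) = begin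
  (not (x ≡ᵇ y) ∧ all≢ x xs) ∧ (all≢ y xs ∧ distinct xs)  ≡⟨ ∧-interchange (not (x ≡ᵇ y)) _ _ _ ⟩
  (not (x ≡ᵇ y) ∧ all≢ y xs) ∧ (all≢ x xs ∧ distinct xs)
    ≡⟨ cong₂ _∧_ (cong₂ (λ b c → not b ∧ c) (≡ᵇ-sym x y) (all-resp-↭ _ xs↭))
                 (cong₂ _∧_ (all-resp-↭ _ xs↭) (distinct-resp-↭ xs↭)) ⟩
  (not (y ≡ᵇ x) ∧ all≢ y ys) ∧ (all≢ x ys ∧ distinct ys)  ∎
  where
  all≢ : ℕ → List ℕ → Bool
  all≢ z = all (λ w → not (z ≡ᵇ w))
distinct-resp-↭ (↭.trans ↭₁ ↭₂) = trans (distinct-resp-↭ ↭₁) (distinct-resp-↭ ↭₂)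

distinct-head∉ : ∀ {x l} → distinct (x ∷ l) ≡ true → x ∉ l
distinct-head∉ {x} {l} d x∈l = BP.not-¬ (≡ᵇ-refl x)
  (BP.not-injective (all-true⁻ (λ w → not (x ≡ᵇ w)) l (proj₁ (∧-true⁻ d)) x∈l))

distinct-tail : ∀ x l → distinct (x ∷ l) ≡ true → distinct l ≡ true
distinct-tail x l d = proj₂ (∧-true⁻ {all (λ w → not (x ≡ᵇ w)) l} d)

distinct-++-pair⇒∉ : ∀ P x y → distinct (P ++ x ∷ y ∷ []) ≡ true → x ∉ P × y ∉ P
distinct-++-pair⇒∉ P x y d = (λ x∈P → distinct-head∉ x∷y∷P (there x∈P)) , distinct-head∉ (distinct-tail x (y ∷ P) x∷y∷P)
  where
  x∷y∷P : distinct (x ∷ y ∷ P) ≡ true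
  x∷y∷P = trans (sym (distinct-resp-↭ (++-comm P (x ∷ y ∷ [])))) d

distinct-repeat : ∀ x l → distinct (x ∷ x ∷ l) ≡ false
distinct-repeat x l = ¬true⇒false λ d → distinct-head∉ {x} {x ∷ l} d (here refl)

distinct⇒lookup-injective : ∀ l → distinct l ≡ true → ∀ {i j} → lookup l i ≡ lookup l j → i ≡ j
distinct⇒lookup-injective (x ∷ l) d {zero}  {zero}  _ = refl
distinct⇒lookup-injective (x ∷ l) d {zero}  {suc j} e = ⊥-elim (distinct-head∉ d (subst (_∈ l) (sym e) (∈-lookup j)))
distinct⇒lookup-injective (x ∷ l) d {suc i} {zero}  e = ⊥-elim (distinct-head∉ d (subst (_∈ l) e (∈-lookup i)))
distinct⇒lookup-injective (x ∷ l) d {suc i} {suc j} e = cong suc (distinct⇒lookup-injective l (distinct-tail x l d) e)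

distinct-length≤ : ∀ N l → distinct l ≡ true → all (_<ᵇ N) l ≡ true → length l ≤ N
distinct-length≤ N l d bounded = FinP.injective⇒≤ {f = f} f-injective
  where
  lookup< : ∀ i → lookup l i < N
  lookup< i = <ᵇ-true⁻ (all-true⁻ (_<ᵇ N) l bounded (∈-lookup i))
  f : Fin (length l) → Fin N
  f i = fromℕ< (lookup< i)
  f-injective : ∀ {i j} → f i ≡ f j → i ≡ j
  f-injective {i} {j} e = distinct⇒lookup-injective l d
    (trans (sym (FinP.toℕ-fromℕ< (lookup< i))) (trans (cong toℕ e) (FinP.toℕ-fromℕ< (lookup< j))))

distinct-bounded⇒complete : ∀ N l → distinct l ≡ true → all (_<ᵇ N) l ≡ true → length l ≡ N →
  ∀ {a} → a < N → a ∈ l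
distinct-bounded⇒complete N l d bounded ∣l∣ {a} a<N with a ∈? l
... | yes a∈l = a∈l
... | no  a∉l = ⊥-elim (ℕP.<-irrefl refl (subst (_≤ N) (cong suc ∣l∣) (distinct-length≤ N (a ∷ l) a∷l-distinct a∷l-bounded)))
  where
  a-fresh : all (λ w → not (a ≡ᵇ w)) l ≡ true
  a-fresh = all-true⁺ _ l λ {w} w∈l → cong not (¬true⇒false λ a≡ᵇw →
    a∉l (subst (_∈ l) (sym (ℕP.≡ᵇ⇒≡ a w (Equivalence.from BP.T-≡ a≡ᵇw))) w∈l))
  a∷l-distinct : distinct (a ∷ l) ≡ true
  a∷l-distinct = cong₂ _∧_ a-fresh d
  a∷l-bounded : all (_<ᵇ N) (a ∷ l) ≡ true
  a∷l-bounded = cong₂ _∧_ (<ᵇ-true⁺ a<N) bounded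

-- σ-paths of lists of positions

-- sigmaPath σ D is σPath (n + n) (entries σ) D by definition.
σPath : ℕ → List ℕ → List Bool → List Bool
σPath m s D = map (λ k → not (any (λ t → tunnelPair D (nth s k) (nth s t)) (upTo (suc k)))) (upTo m)

σLetter : List Bool → List ℕ → ℕ → Bool
σLetter D s k = not (any (tunnelPair D (nth s k)) (take (suc k) s))

applyUpTo-nth : ∀ s {j} → j ≤ length s → applyUpTo (nth s) j ≡ take j s
applyUpTo-nth s       {zero}  _        = refl
applyUpTo-nth (x ∷ s) {suc j} (s≤s j≤) = cong (x ∷_) (applyUpTo-nth s j≤)

any-upTo-nth : ∀ (p : ℕ → Bool) s {j} → j ≤ length s → any (λ t → p (nth s t)) (upTo j) ≡ any p (take j s)
any-upTo-nth p s {j} j≤ = cong or (begin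
  map (λ t → p (nth s t)) (upTo j)  ≡⟨ ListP.map-upTo _ j ⟩
  applyUpTo (λ t → p (nth s t)) j   ≡⟨ ListP.map-applyUpTo (nth s) p j ⟨
  map p (applyUpTo (nth s) j)       ≡⟨ cong (map p) (applyUpTo-nth s j≤) ⟩
  map p (take j s)                  ∎)

σPath-letters : ∀ {m} D s → length s ≡ m → σPath m s D ≡ map (σLetter D s) (upTo m)
σPath-letters {m} D s refl = ListP.map-cong-local (applyUpTo⁺₁ (λ k → k) m λ k<m →
  cong not (any-upTo-nth (tunnelPair D (nth s _)) s k<m))

σPath-cong : ∀ {m} D s s′ → length s ≡ m → length s′ ≡ m →
  (∀ {k} → k < m → σLetter D s k ≡ σLetter D s′ k) → σPath m s D ≡ σPath m s′ D
σPath-cong {m} D s s′ ∣s∣ ∣s′∣ same = begin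
  σPath m s D                ≡⟨ σPath-letters D s ∣s∣ ⟩
  map (σLetter D s) (upTo m)  ≡⟨ ListP.map-cong-local (applyUpTo⁺₁ (λ k → k) m same) ⟩
  map (σLetter D s′) (upTo m) ≡⟨ σPath-letters D s′ ∣s′∣ ⟨
  σPath m s′ D               ∎

σLetter-swap-front : ∀ D x y l k → σLetter D (x ∷ y ∷ l) k ≡ σLetter D (y ∷ x ∷ l) k
σLetter-swap-front D x y l zero
  rewrite tunnelPair-irrefl D x | tunnelPair-irrefl D y = refl
σLetter-swap-front D x y l (suc zero)
  rewrite tunnelPair-irrefl D x | tunnelPair-irrefl D y | tunnelPair-sym D x y = refl
σLetter-swap-front D x y l (suc (suc k)) = cong not (∨-exchange (tunnelPair D z x) (tunnelPair D z y) _)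
  where
  z : ℕ
  z = nth l k

σPath-swap-front : ∀ {m} D x y l → length (x ∷ y ∷ l) ≡ m → σPath m (x ∷ y ∷ l) D ≡ σPath m (y ∷ x ∷ l) D
σPath-swap-front D x y l ∣l∣ = σPath-cong D (x ∷ y ∷ l) (y ∷ x ∷ l) ∣l∣ ∣l∣ λ {k} _ → σLetter-swap-front D x y l k

nth-++ˡ : ∀ P r {k} → k < length P → nth (P ++ r) k ≡ nth P k
nth-++ˡ (p ∷ P) r {zero}  _        = refl
nth-++ˡ (p ∷ P) r {suc k} (s≤s k<) = nth-++ˡ P r k<

nth-++ʳ : ∀ P r j → nth (P ++ r) (length P + j) ≡ nth r j
nth-++ʳ []      r j = refl
nth-++ʳ (p ∷ P) r j = nth-++ʳ P r j

take-++ˡ : ∀ {A : Set} (P r : List A) {j} → j ≤ length P → take j (P ++ r) ≡ take j P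
take-++ˡ P       r {zero}  _        = refl
take-++ˡ (p ∷ P) r {suc j} (s≤s j≤) = cong (p ∷_) (take-++ˡ P r j≤)

take-++ʳ : ∀ {A : Set} (P r : List A) j → take (length P + j) (P ++ r) ≡ P ++ take j r
take-++ʳ []      r j = refl
take-++ʳ (p ∷ P) r j = cong (p ∷_) (take-++ʳ P r j)

σLetter-++ˡ : ∀ D P r r′ {k} → k < length P → σLetter D (P ++ r) k ≡ σLetter D (P ++ r′) k
σLetter-++ˡ D P r r′ k< = cong₂ (λ z zs → not (any (tunnelPair D z) zs))
  (trans (nth-++ˡ P r k<) (sym (nth-++ˡ P r′ k<)))
  (trans (take-++ˡ P r k<) (sym (take-++ˡ P r′ k<)))

σLetter-++ʳ : ∀ D P r j → σLetter D (P ++ r) (length P + j) ≡ not (any (tunnelPair D (nth r j)) (P ++ take (suc j) r))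
σLetter-++ʳ D P r j = cong₂ (λ z zs → not (any (tunnelPair D z) zs)) (nth-++ʳ P r j)
  (trans (cong (λ i → take i (P ++ r)) (sym (ℕP.+-suc (length P) j))) (take-++ʳ P r (suc j)))

TunnelClosed : List Bool → List ℕ → Set
TunnelClosed D L = ∀ {a} → a ∈ L → ∃[ b ] b ∈ L × tunnelPair D a b ≡ true

module _ (D : List Bool) (P : List ℕ) (x y : ℕ) (y∉P : y ∉ P) (closed : TunnelClosed D (P ++ x ∷ y ∷ [])) where

  any-tunnelPair-prefix : any (tunnelPair D x) P ≡ not (tunnelPair D x y)
  any-tunnelPair-prefix with tunnelPair D x y in xy
  ... | true  = ¬true⇒false λ x~P → let z , z∈P , xz = any-true⁻ _ P x~P in
                  y∉P (subst (_∈ P) (tunnelPair-functional D xz xy) z∈P)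
  ... | false with b , b∈ , xb ← closed (∈-++⁺ʳ P (here refl)) with ∈-++⁻ P b∈
  ...   | inj₁ b∈P               = any-true⁺ _ b∈P xb
  ...   | inj₂ (here refl)         = ⊥-elim (BP.not-¬ xb (tunnelPair-irrefl D x))
  ...   | inj₂ (there (here refl)) = ⊥-elim (BP.not-¬ xb xy)

  σLetter-penultimate : σLetter D (P ++ x ∷ y ∷ []) (length P) ≡ tunnelPair D x y
  σLetter-penultimate = begin
    σLetter D (P ++ x ∷ y ∷ []) (length P)       ≡⟨ cong (σLetter D (P ++ x ∷ y ∷ [])) (ℕP.+-identityʳ _) ⟨
    σLetter D (P ++ x ∷ y ∷ []) (length P + 0)   ≡⟨ σLetter-++ʳ D P (x ∷ y ∷ []) 0 ⟩
    not (any (tunnelPair D x) (P ++ x ∷ []))     ≡⟨ cong not (any-++ _ P (x ∷ [])) ⟩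
    not (any (tunnelPair D x) P ∨ (tunnelPair D x x ∨ false))
      ≡⟨ cong (λ b → not (any (tunnelPair D x) P ∨ (b ∨ false))) (tunnelPair-irrefl D x) ⟩
    not (any (tunnelPair D x) P ∨ false)         ≡⟨ cong not (BP.∨-identityʳ _) ⟩
    not (any (tunnelPair D x) P)                 ≡⟨ cong not any-tunnelPair-prefix ⟩
    not (not (tunnelPair D x y))                 ≡⟨ BP.not-involutive _ ⟩
    tunnelPair D x y                             ∎

  σLetter-last : σLetter D (P ++ x ∷ y ∷ []) (suc (length P)) ≡ false
  σLetter-last with b , b∈ , yb ← closed (∈-++⁺ʳ P (there (here refl))) = begin
    σLetter D (P ++ x ∷ y ∷ []) (suc (length P))     ≡⟨ cong (σLetter D (P ++ x ∷ y ∷ [])) (ℕP.+-comm (length P) 1) ⟨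
    σLetter D (P ++ x ∷ y ∷ []) (length P + 1)       ≡⟨ σLetter-++ʳ D P (x ∷ y ∷ []) 1 ⟩
    not (any (tunnelPair D y) (P ++ x ∷ y ∷ []))     ≡⟨ cong not (any-true⁺ _ b∈ yb) ⟩
    false                                            ∎

swap-back↭ : ∀ {A : Set} (P : List A) x y → P ++ x ∷ y ∷ [] ↭ P ++ y ∷ x ∷ []
swap-back↭ P x y = ++⁺ˡ P (↭-swap x y ↭-refl)

σPath-swap-back : ∀ {m} D P x y → length (P ++ x ∷ y ∷ []) ≡ m → x ∉ P → y ∉ P →
  TunnelClosed D (P ++ x ∷ y ∷ []) → σPath m (P ++ x ∷ y ∷ []) D ≡ σPath m (P ++ y ∷ x ∷ []) D
σPath-swap-back {m} D P x y ∣L∣ x∉P y∉P closed = σPath-cong D (P ++ x ∷ y ∷ []) (P ++ y ∷ x ∷ []) ∣L∣ ∣L′∣ same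
  where
  L↭L′ : P ++ x ∷ y ∷ [] ↭ P ++ y ∷ x ∷ []
  L↭L′ = swap-back↭ P x y
  ∣L′∣ : length (P ++ y ∷ x ∷ []) ≡ m
  ∣L′∣ = trans (sym (↭-length L↭L′)) ∣L∣
  closed′ : TunnelClosed D (P ++ y ∷ x ∷ [])
  closed′ a∈ with b , b∈ , ab ← closed (∈-resp-↭ (↭-sym L↭L′) a∈) = b , ∈-resp-↭ L↭L′ b∈ , ab
  same : ∀ {k} → k < m → σLetter D (P ++ x ∷ y ∷ []) k ≡ σLetter D (P ++ y ∷ x ∷ []) k
  same {k} k<m with ℕP.<-cmp k (length P)
  ... | tri< k<P _ _ = σLetter-++ˡ D P _ _ k<P
  ... | tri≈ _ refl _ = trans (σLetter-penultimate D P x y y∉P closed)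
                       (trans (tunnelPair-sym D x y) (sym (σLetter-penultimate D P y x x∉P closed′)))
  ... | tri> _ _ P<k = subst (λ k → σLetter D (P ++ x ∷ y ∷ []) k ≡ σLetter D (P ++ y ∷ x ∷ []) k) k≡
          (trans (σLetter-last D P x y y∉P closed) (sym (σLetter-last D P y x x∉P closed′)))
    where
    k≡ : suc (length P) ≡ k
    k≡ = ℕP.≤-antisym P<k (ℕP.≤-pred (subst (k <_) (trans (sym ∣L∣) (trans (ListP.length-++ P) (ℕP.+-comm (length P) 2))) k<m))

-- Counting words by their first and last two entries

∑-cong : ∀ {m} {f g : Fin m → ℕ} → (∀ i → f i ≡ g i) → ∑ f ≡ ∑ g
∑-cong = sum-cong-≗

∑-∣ : ∀ {d} m (f : Fin m → ℕ) → (∀ i → d ∣ f i) → d ∣ ∑ f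
∑-∣ zero    f _   = _ ∣0
∑-∣ (suc m) f d∣f = ∣m∣n⇒∣m+n (d∣f zero) (∑-∣ m (λ i → f (suc i)) (λ i → d∣f (suc i)))

∑-≥ : ∀ m (f : Fin m → ℕ) i → f i ≤ ∑ f
∑-≥ (suc m) f zero    = ℕP.m≤m+n (f zero) _
∑-≥ (suc m) f (suc i) = ℕP.≤-trans (∑-≥ m (λ i → f (suc i)) i) (ℕP.m≤n+m _ (f zero))

∑∑-symmetric-∣ : ∀ {d} m (h : Fin m → Fin m → ℕ) → (∀ i j → h i j ≡ h j i) → (∀ i → h i i ≡ 0) →
  (∀ i j → d ∣ h i j) → 2 * d ∣ ∑[ i < m ] ∑[ j < m ] h i j
∑∑-symmetric-∣ zero    h sym-h diag d∣h = _ ∣0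
∑∑-symmetric-∣ {d} (suc m) h sym-h diag d∣h = subst (2 * d ∣_) (sym split)
  (∣m∣n⇒∣m+n (subst (2 * d ∣_) (cong (S +_) (ℕP.+-identityʳ S)) (*-monoʳ-∣ 2 (∑-∣ m _ (λ j → d∣h zero (suc j)))))
             (∑∑-symmetric-∣ m (λ i j → h (suc i) (suc j)) (λ i j → sym-h (suc i) (suc j)) (λ i → diag (suc i))
                (λ i j → d∣h (suc i) (suc j))))
  where
  S R : ℕ
  S = ∑[ j < m ] h zero (suc j)
  R = ∑[ i < m ] ∑[ j < m ] h (suc i) (suc j)
  split : ∑[ i < suc m ] ∑[ j < suc m ] h i j ≡ (S + S) + R
  split = begin
    (h zero zero + S) + ∑[ i < m ] (h (suc i) zero + ∑[ j < m ] h (suc i) (suc j))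
      ≡⟨ cong₂ (λ a b → (a + S) + b) (diag zero) (∑-distrib-+ {m} _ _) ⟩
    S + (∑[ i < m ] h (suc i) zero + R)  ≡⟨ cong (λ a → S + (a + R)) (∑-cong {m} (λ i → sym-h (suc i) zero)) ⟩
    S + (S + R)                          ≡⟨ ℕP.+-assoc S S R ⟨
    (S + S) + R                          ∎

sum-map-concatMap : ∀ {A B : Set} (f : B → ℕ) (g : A → List B) xs →
  sum (map f (concatMap g xs)) ≡ sum (map (λ x → sum (map f (g x))) xs)
sum-map-concatMap f g []       = refl
sum-map-concatMap f g (x ∷ xs) = begin
  sum (map f (g x ++ concatMap g xs))              ≡⟨ cong sum (ListP.map-++ f (g x) _) ⟩
  sum (map f (g x) ++ map f (concatMap g xs))      ≡⟨ SumP.sum-++ (map f (g x)) _ ⟩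
  sum (map f (g x)) + sum (map f (concatMap g xs)) ≡⟨ cong (sum (map f (g x)) +_) (sum-map-concatMap f g xs) ⟩
  sum (map f (g x)) + sum (map (λ x → sum (map f (g x))) xs) ∎

sum-tabulate : ∀ {m} (f : Fin m → ℕ) → sum (tabulate f) ≡ ∑ f
sum-tabulate {zero}  f = refl
sum-tabulate {suc m} f = cong (f zero +_) (sum-tabulate (λ i → f (suc i)))

sum-map-allFin : ∀ m (f : Fin m → ℕ) → sum (map f (allFin m)) ≡ ∑ f
sum-map-allFin m f = trans (cong sum (ListP.map-tabulate (λ i → i) f)) (sum-tabulate f)

toℕs : ∀ {m K} → Vec (Fin m) K → List ℕ
toℕs v = toList (Vec.map toℕ v)

count : ℕ → ℕ → (List ℕ → ℕ) → ℕ
count m K G = sum (map (λ v → G (toℕs v)) (allVecs m K))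

count-cong : ∀ m K {G G′ : List ℕ → ℕ} → (∀ l → G l ≡ G′ l) → count m K G ≡ count m K G′
count-cong m K G≗G′ = cong sum (ListP.map-cong (λ v → G≗G′ (toℕs v)) (allVecs m K))

count-zero : ∀ m K {G : List ℕ → ℕ} → (∀ l → G l ≡ 0) → count m K G ≡ 0
count-zero m K {G} G≗0 = go (allVecs m K)
  where
  go : (vs : List (Vec (Fin m) K)) → sum (map (λ v → G (toℕs v)) vs) ≡ 0
  go []       = refl
  go (v ∷ vs) = cong₂ _+_ (G≗0 (toℕs v)) (go vs)

count-∷ : ∀ m K G → count m (suc K) G ≡ ∑[ i < m ] count m K (λ l → G (toℕ i ∷ l))
count-∷ m K G = begin
  count m (suc K) G
    ≡⟨ sum-map-concatMap (λ v → G (toℕs v)) (λ i → map (i ∷_) (allVecs m K)) (allFin m) ⟩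
  sum (map (λ i → sum (map (λ v → G (toℕs v)) (map (i ∷_) (allVecs m K)))) (allFin m))
    ≡⟨ cong sum (ListP.map-cong (λ i → cong sum (ListP.map-∘ (allVecs m K))) (allFin m)) ⟨
  sum (map (λ i → count m K (λ l → G (toℕ i ∷ l))) (allFin m))
    ≡⟨ sum-map-allFin m _ ⟩
  ∑[ i < m ] count m K (λ l → G (toℕ i ∷ l)) ∎

count-∷ʳ : ∀ m K G → count m (suc K) G ≡ ∑[ i < m ] count m K (λ l → G (l ++ toℕ i ∷ []))
count-∷ʳ m zero    G = count-∷ m zero G
count-∷ʳ m (suc K) G = begin
  count m (suc (suc K)) G                                                ≡⟨ count-∷ m (suc K) G ⟩
  ∑[ i < m ] count m (suc K) (λ l → G (toℕ i ∷ l))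
    ≡⟨ ∑-cong {m} (λ i → count-∷ʳ m K (λ l → G (toℕ i ∷ l))) ⟩
  ∑[ i < m ] ∑[ j < m ] count m K (λ l → G (toℕ i ∷ l ++ toℕ j ∷ []))  ≡⟨ ∑-comm {m} {m} _ ⟩
  ∑[ j < m ] ∑[ i < m ] count m K (λ l → G (toℕ i ∷ l ++ toℕ j ∷ []))
    ≡⟨ ∑-cong {m} (λ j → count-∷ m K (λ l → G (l ++ toℕ j ∷ []))) ⟨
  ∑[ j < m ] count m (suc K) (λ l → G (l ++ toℕ j ∷ []))               ∎

count-≥ : ∀ m K G (v : Vec (Fin m) K) → G (toℕs v) ≤ count m K G
count-≥ m zero    G []      = ℕP.m≤m+n (G []) 0
count-≥ m (suc K) G (i ∷ v) = ℕP.≤-trans (count-≥ m K (λ l → G (toℕ i ∷ l)) v)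
  (subst (count m K (λ l → G (toℕ i ∷ l)) ≤_) (sym (count-∷ m K G)) (∑-≥ m (λ j → count m K (λ l → G (toℕ j ∷ l))) i))

SwapInvariantFront SwapInvariantBack VanishesOnRepeatFront VanishesOnRepeatBack : (List ℕ → ℕ) → Set
SwapInvariantFront G    = ∀ x y l → G (x ∷ y ∷ l) ≡ G (y ∷ x ∷ l)
SwapInvariantBack G     = ∀ l x y → G (l ++ x ∷ y ∷ []) ≡ G (l ++ y ∷ x ∷ [])
VanishesOnRepeatFront G = ∀ x l → G (x ∷ x ∷ l) ≡ 0
VanishesOnRepeatBack G  = ∀ l x → G (l ++ x ∷ x ∷ []) ≡ 0

two-∣-count : ∀ m K G → SwapInvariantBack G → VanishesOnRepeatBack G → 2 ∣ count m (suc (suc K)) G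
two-∣-count m K G swap repeat = subst (2 ∣_) (sym split)
  (∑∑-symmetric-∣ m h (λ i j → count-cong m K (λ l → swap l (toℕ j) (toℕ i)))
     (λ i → count-zero m K (λ l → repeat l (toℕ i))) (λ _ _ → 1∣ _))
  where
  h : Fin m → Fin m → ℕ
  h i j = count m K (λ l → G (l ++ toℕ j ∷ toℕ i ∷ []))
  split : count m (suc (suc K)) G ≡ ∑[ i < m ] ∑[ j < m ] h i j
  split = trans (count-∷ʳ m (suc K) G) (∑-cong {m} λ i → trans (count-∷ʳ m K (λ l → G (l ++ toℕ i ∷ [])))
            (∑-cong {m} λ j → count-cong m K (λ l → cong G (ListP.++-assoc l (toℕ j ∷ []) (toℕ i ∷ [])))))

four-∣-count : ∀ m K G → SwapInvariantFront G → VanishesOnRepeatFront G →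
  SwapInvariantBack G → VanishesOnRepeatBack G → 4 ∣ count m (suc (suc (suc (suc K)))) G
four-∣-count m K G swap-front repeat-front swap-back repeat-back = subst (4 ∣_) (sym split)
  (∑∑-symmetric-∣ m h (λ i j → count-cong m (suc (suc K)) (swap-front (toℕ i) (toℕ j)))
     (λ i → count-zero m (suc (suc K)) (repeat-front (toℕ i)))
     (λ i j → two-∣-count m K (λ l → G (toℕ i ∷ toℕ j ∷ l)) (λ l → swap-back (toℕ i ∷ toℕ j ∷ l)) (λ l → repeat-back (toℕ i ∷ toℕ j ∷ l))))
  where
  h : Fin m → Fin m → ℕ
  h i j = count m (suc (suc K)) (λ l → G (toℕ i ∷ toℕ j ∷ l))
  split : count m (suc (suc (suc (suc K)))) G ≡ ∑[ i < m ] ∑[ j < m ] h i j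
  split = trans (count-∷ m (suc (suc (suc K))) G) (∑-cong {m} λ i → count-∷ m (suc (suc K)) (λ l → G (toℕ i ∷ l)))

-- The length and range tests hold for all entries of vectors (classIndicator-toℕs);
-- they are part of the indicator so that the swap lemmas hold for arbitrary lists.
isPermList : ℕ → List ℕ → Bool
isPermList N l = (length l ≡ᵇ N) ∧ (all (_<ᵇ N) l ∧ distinct l)

isPermList-resp-↭ : ∀ N {l l′} → l ↭ l′ → isPermList N l ≡ isPermList N l′
isPermList-resp-↭ N l↭ = cong₂ _∧_ (cong (_≡ᵇ N) (↭-length l↭)) (cong₂ _∧_ (all-resp-↭ _ l↭) (distinct-resp-↭ l↭))

isPermList-nondistinct : ∀ N l → distinct l ≡ false → isPermList N l ≡ false
isPermList-nondistinct N l d rewrite d | BP.∧-zeroʳ (all (_<ᵇ N) l) = BP.∧-zeroʳ _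

record PermList (N : ℕ) (l : List ℕ) : Set where
  field
    length≡ : length l ≡ N
    bounded : all (_<ᵇ N) l ≡ true
    unique  : distinct l ≡ true

isPermList-true⁻ : ∀ N l → isPermList N l ≡ true → PermList N l
isPermList-true⁻ N l e with ∣l∣ , rest ← ∧-true⁻ e with bounded , unique ← ∧-true⁻ rest =
  record { length≡ = ℕP.≡ᵇ⇒≡ _ _ (Equivalence.from BP.T-≡ ∣l∣) ; bounded = bounded ; unique = unique }

allWords-length : ∀ k {w} → w ∈ allWords k → length w ≡ k
allWords-length zero    (here refl) = refl
allWords-length (suc k) w∈ with ∈-concatMap⁻ (λ b → map (b ∷_) (allWords k)) {xs = true ∷ false ∷ []} w∈
... | here w∈map         with v , v∈ , refl ← ∈-map⁻ (true ∷_) w∈map  = cong suc (allWords-length k v∈)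
... | there (here w∈map) with v , v∈ , refl ← ∈-map⁻ (false ∷_) w∈map = cong suc (allWords-length k v∈)

dyckPaths-member : ∀ n {D} → D ∈ dyckPaths n → isDyck D ≡ true × length D ≡ n + n
dyckPaths-member n D∈ with D∈words , dyck ← ∈-filter⁻ (λ w → isDyck w Bool.≟ true) D∈ =
  dyck , allWords-length (n + n) D∈words

module _ n {D l} (D∈ : D ∈ dyckPaths n) (perm : PermList (n + n) l) where
  open PermList perm

  PermList⇒TunnelClosed : TunnelClosed D l
  PermList⇒TunnelClosed {a} a∈
    with dyck , ∣D∣ ← dyckPaths-member n D∈
    with b , b< , ab ← Dyck⇒tunnelPair-total D dyck (subst (a <_) (sym ∣D∣) (<ᵇ-true⁻ (all-true⁻ _ l bounded a∈)))
    = b , distinct-bounded⇒complete (n + n) l unique bounded length≡ (subst (b <_) ∣D∣ b<) , ab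

σPathsAgree : (n : ℕ) → Vec (Fin (n + n)) (n + n) → List ℕ → Bool
σPathsAgree n σ l = all (λ D → σPath (n + n) l D ==w sigmaPath σ D) (dyckPaths n)

classIndicator : (n : ℕ) → Vec (Fin (n + n)) (n + n) → List ℕ → ℕ
classIndicator n σ l = if isPermList (n + n) l ∧ σPathsAgree n σ l then 1 else 0

module _ (n : ℕ) (σ : Vec (Fin (n + n)) (n + n)) where

  classIndicator-cong : ∀ l l′ → isPermList (n + n) l ≡ isPermList (n + n) l′ →
    (PermList (n + n) l → ∀ {D} → D ∈ dyckPaths n → σPath (n + n) l D ≡ σPath (n + n) l′ D) →
    classIndicator n σ l ≡ classIndicator n σ l′
  classIndicator-cong l l′ same-perm same-paths with isPermList (n + n) l in perm
  ... | false rewrite sym same-perm = refl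
  ... | true  rewrite sym same-perm = cong (λ b → if b then 1 else 0)
    (all-cong-local (dyckPaths n) λ {D} D∈ → cong (_==w sigmaPath σ D)
      (same-paths (isPermList-true⁻ (n + n) l perm) D∈))

  classIndicator-nondistinct : ∀ l → distinct l ≡ false → classIndicator n σ l ≡ 0
  classIndicator-nondistinct l d =
    cong (λ b → if b ∧ σPathsAgree n σ l then 1 else 0) (isPermList-nondistinct (n + n) l d)

  classIndicator-swap-front : ∀ x y l → classIndicator n σ (x ∷ y ∷ l) ≡ classIndicator n σ (y ∷ x ∷ l)
  classIndicator-swap-front x y l = classIndicator-cong (x ∷ y ∷ l) (y ∷ x ∷ l) (isPermList-resp-↭ (n + n) (↭-swap x y (↭-refl {x = l})))
    λ perm {D} _ → σPath-swap-front D x y l (PermList.length≡ perm)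

  classIndicator-repeat-front : ∀ x l → classIndicator n σ (x ∷ x ∷ l) ≡ 0
  classIndicator-repeat-front x l = classIndicator-nondistinct (x ∷ x ∷ l) (distinct-repeat x l)

  classIndicator-swap-back : ∀ P x y → classIndicator n σ (P ++ x ∷ y ∷ []) ≡ classIndicator n σ (P ++ y ∷ x ∷ [])
  classIndicator-swap-back P x y = classIndicator-cong (P ++ x ∷ y ∷ []) (P ++ y ∷ x ∷ [])
    (isPermList-resp-↭ (n + n) (swap-back↭ P x y)) same-paths
    where
    same-paths : PermList (n + n) (P ++ x ∷ y ∷ []) → ∀ {D} → D ∈ dyckPaths n →
      σPath (n + n) (P ++ x ∷ y ∷ []) D ≡ σPath (n + n) (P ++ y ∷ x ∷ []) D
    same-paths perm {D} D∈ with x∉P , y∉P ← distinct-++-pair⇒∉ P x y (PermList.unique perm) =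
      σPath-swap-back D P x y (PermList.length≡ perm) x∉P y∉P (PermList⇒TunnelClosed n D∈ perm)

  classIndicator-repeat-back : ∀ P x → classIndicator n σ (P ++ x ∷ x ∷ []) ≡ 0
  classIndicator-repeat-back P x =
    classIndicator-nondistinct (P ++ x ∷ x ∷ []) (trans (distinct-resp-↭ (++-comm P (x ∷ x ∷ []))) (distinct-repeat x P))

toℕs-length : ∀ {m K} (v : Vec (Fin m) K) → length (toℕs v) ≡ K
toℕs-length []      = refl
toℕs-length (i ∷ v) = cong suc (toℕs-length v)

toℕs-bounded : ∀ {m K} (v : Vec (Fin m) K) → all (_<ᵇ m) (toℕs v) ≡ true
toℕs-bounded []      = refl
toℕs-bounded (i ∷ v) = cong₂ _∧_ (<ᵇ-true⁺ (FinP.toℕ<n i)) (toℕs-bounded v)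

length-filter-sum : ∀ {A : Set} (p : A → Bool) xs →
  length (filter (λ x → p x Bool.≟ true) xs) ≡ sum (map (λ x → if p x then 1 else 0) xs)
length-filter-sum p []       = refl
length-filter-sum p (x ∷ xs) with p x
... | true  = cong suc (length-filter-sum p xs)
... | false = length-filter-sum p xs

classIndicator-toℕs : ∀ n σ (μ : Vec (Fin (n + n)) (n + n)) →
  (if isPerm μ ∧ equiv n μ σ then 1 else 0) ≡ classIndicator n σ (toℕs μ)
classIndicator-toℕs n σ μ rewrite toℕs-length μ | ≡ᵇ-refl (n + n) | toℕs-bounded μ = refl

classSize≡count : ∀ n σ → classSize n σ ≡ count (n + n) (n + n) (classIndicator n σ)
classSize≡count n σ = trans (length-filter-sum (λ μ → isPerm μ ∧ equiv n μ σ) (allVecs (n + n) (n + n)))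
  (cong sum (ListP.map-cong (classIndicator-toℕs n σ) (allVecs (n + n) (n + n))))

classIndicator-self : ∀ n σ → isPerm σ ≡ true → classIndicator n σ (toℕs σ) ≡ 1
classIndicator-self n σ perm = trans (sym (classIndicator-toℕs n σ σ))
  (cong (λ b → if b then 1 else 0) (trans (cong (_∧ equiv n σ σ) perm)
    (all-true⁺ _ (dyckPaths n) λ {D} _ → ⌊⌋-true⁺ (ListP.≡-dec BP._≟_ (sigmaPath σ D) (sigmaPath σ D)) refl)))

proposition2 : (n : ℕ) → 3 ≤ n → (σ : Vec (Fin (n + n)) (n + n)) → isPerm σ ≡ true
    → 4 ≤ classSize n σ × 4 ∣ classSize n σ
proposition2 n 3≤n σ perm =
  subst (4 ≤_) (sym size) (∣⇒≤ ⦃ >-nonZero positive ⦄ four-divides) , subst (4 ∣_) (sym size) four-divides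
  where
  N : ℕ
  N = n + n
  G : List ℕ → ℕ
  G = classIndicator n σ
  size : classSize n σ ≡ count N N G
  size = classSize≡count n σ
  4≤N : 4 ≤ N
  4≤N = ℕP.+-mono-≤ 2≤n 2≤n
    where
    2≤n : 2 ≤ n
    2≤n = ℕP.≤-trans (ℕP.n≤1+n 2) 3≤n
  four-divides : 4 ∣ count N N G
  four-divides = subst (λ K → 4 ∣ count N K G) (ℕP.m+[n∸m]≡n 4≤N)
    (four-∣-count N (N ∸ 4) G (classIndicator-swap-front n σ) (classIndicator-repeat-front n σ)
                              (classIndicator-swap-back n σ) (classIndicator-repeat-back n σ))
  positive : 0 < count N N G
  positive = subst (_≤ count N N G) (classIndicator-self n σ perm) (count-≥ N N G σ)
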